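{- Let $\mathcal{D}$ be a partial geometric design with $v\times b$ incidence matrix $N$ whose concurrence matrix $NN^T$ is circulant. Then for any positive integers $m,n$, the points of the incidence structure $\mathcal{D}\otimes J_{m,n}$ (whose incidence matrix is the Kronecker product $N\otimes J_{m,n}$) can be ordered so that its concurrence matrix is circulant.
   Context: A partial geometric design with parameters $(v,b,k,r;\alpha,\beta)$ is a tactical configuration (each block has $k$ points, each point lies in $r$ blocks, repeated blocks allowed) whose incidence matrix $N$ satisfies $NN^TN=\beta N+\alpha(J-N)$. The concurrence matrix is $NN^T$ with rows and columns indexed by the points in some order. $J_{m,n}$ is the $m\times n$ all-ones matrix; $\mathcal{D}\otimes J_{m,n}$ is the incidence structure obtained by replacing every point by $m$ points and repeating every block $n$ times, i.e., with incidence matrix $N\otimes J_{m,n}$. A square matrix is circulant if its $(i,j)$ entry depends only on $j-i$ modulo its order. -}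

module Defs where

open import Data.Nat using (ℕ; zero; suc; _+_; _*_; _∸_)
open import Data.Fin using (Fin; zero; suc; toℕ; quotient)
open import Data.Integer as ℤ using (ℤ; +_)
open import Data.Integer.Divisibility using () renaming (_∣_ to _∣ℤ_)
open import Data.Fin.Permutation using (Permutation′; _⟨$⟩ʳ_)
open import Data.Product using (_×_)
open import Data.Sum using (_⊎_)
open import Relation.Binary.PropositionalEquality using (_≡_)

Σ[<_]_ : (n : ℕ) → (Fin n → ℕ) → ℕ
Σ[< zero ] f = 0
Σ[< suc n ] f = f zero + Σ[< n ] (λ i → f (suc i))

-- A v × b matrix with natural entries (rows = points, columns = blocks).
Mat : ℕ → ℕ → Set
Mat v b = Fin v → Fin b → ℕ

transpose : ∀ {v b} → Mat v b → Mat b v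
transpose N j i = N i j

_⊛_ : ∀ {p q s} → Mat p q → Mat q s → Mat p s
(A ⊛ B) i j = Σ[< _ ] (λ l → A i l * B l j)

concurrence : ∀ {v b} → Mat v b → Mat v v
concurrence N = N ⊛ transpose N

Is01 : ∀ {v b} → Mat v b → Set
Is01 N = ∀ i j → (N i j ≡ 0) ⊎ (N i j ≡ 1)

-- Tactical configuration: every block has k points, every point lies in r blocks
-- (repeated blocks allowed, i.e. repeated columns allowed).
IsTactical : ∀ {v b} → Mat v b → ℕ → ℕ → Set
IsTactical {v} {b} N k r =
  Is01 N × (∀ j → Σ[< v ] (λ i → N i j) ≡ k) × (∀ i → Σ[< b ] (λ j → N i j) ≡ r)

-- Partial geometric design with parameters (v,b,k,r;α,β):
-- N N^T N = β N + α (J − N)   (entrywise; J − N is 1 ∸ N since N is 0/1).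
IsPGD : ∀ {v b} → Mat v b → (k r α β : ℕ) → Set
IsPGD N k r α β =
  IsTactical N k r ×
  (∀ i j → (concurrence N ⊛ N) i j ≡ β * N i j + α * (1 ∸ N i j))

IsCirculant : ∀ {n} → Mat n n → Set
IsCirculant {n} M =
  ∀ i j i' j' →
    (+ n) ∣ℤ ((+ toℕ j ℤ.- + toℕ i) ℤ.- (+ toℕ j' ℤ.- + toℕ i')) →
    M i j ≡ M i' j'

-- Kronecker product N ⊗ J_{m,n}: point (i,a) ↦ index i*m + a, block (j,c) ↦ j*n + c.
_⊗J[_,_] : ∀ {v b} → Mat v b → (m n : ℕ) → Mat (v * m) (b * n)
(N ⊗J[ m , n ]) x y = N (quotient m x) (quotient n y)

reorderRows : ∀ {p q} → Permutation′ p → Mat p q → Mat p q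
reorderRows σ N i j = N (σ ⟨$⟩ʳ i) j

-- Reorder the points (i, a) of N ⊗ J_{m,n} so that position x carries a point with i ≡ x (mod v).  Each block of D is repeated n times, so the concurrence of two points of
-- N ⊗ J_{m,n} is n times the concurrence in D of their first coordinates; and since v divides vm,
-- positions whose offsets agree modulo vm have first coordinates whose offsets agree modulo v.
module Submission where

open import Defs
open import Data.Nat using (ℕ; zero; suc; _+_; _*_; _≥_)
open import Data.Nat.Properties using (*-comm; *-distribˡ-+; *-zeroʳ; +-assoc)
open import Data.Nat.Divisibility using (∣-trans; m∣m*n) renaming (_∣_ to _∣ℕ_)
open import Data.Product using (Σ; _,_; proj₁; uncurry; swap)
open import Data.Fin using (Fin; zero; suc; toℕ; quotient; remainder; remQuot; combine; cast; _↑ˡ_; _↑ʳ_)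
open import Data.Fin.Properties using (remQuot-combine; combine-remQuot; toℕ-combine; toℕ-cast)
open import Data.Fin.Permutation using (Permutation; Permutation′; permutation; cast-id; _∘ₚ_; _⟨$⟩ʳ_)
open import Data.Integer using (ℤ; +_; _-_)
import Data.Integer as ℤ
open import Data.Integer.Properties using (pos-+; pos-*)
open import Data.Integer.Divisibility.Signed using (_∣_; divides; ∣ᵤ⇒∣; ∣⇒∣ᵤ; ∣m∣n⇒∣m-n)
open import Data.Integer.Tactic.RingSolver using (solve-∀)
open import Relation.Binary.PropositionalEquality using (_≡_; refl; sym; trans; cong; cong₂; subst; module ≡-Reasoning)
open ≡-Reasoning

Σ-cong : ∀ n {f g : Fin n → ℕ} → (∀ i → f i ≡ g i) → Σ[< n ] f ≡ Σ[< n ] g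
Σ-cong zero    f≡g = refl
Σ-cong (suc n) f≡g = cong₂ _+_ (f≡g zero) (Σ-cong n (λ i → f≡g (suc i)))

Σ-++ : ∀ n p (f : Fin (n + p) → ℕ) →
  Σ[< n + p ] f ≡ Σ[< n ] (λ i → f (i ↑ˡ p)) + Σ[< p ] (λ j → f (n ↑ʳ j))
Σ-++ zero    p f = refl
Σ-++ (suc n) p f = trans (cong (_+_ (f zero)) (Σ-++ n p (λ i → f (suc i)))) (sym (+-assoc (f zero) _ _))

Σ-const : ∀ n c → Σ[< n ] (λ _ → c) ≡ n * c
Σ-const zero    c = refl
Σ-const (suc n) c = cong (_+_ c) (Σ-const n c)

Σ-distribˡ : ∀ n c (f : Fin n → ℕ) → Σ[< n ] (λ i → c * f i) ≡ c * Σ[< n ] f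
Σ-distribˡ zero    c f = sym (*-zeroʳ c)
Σ-distribˡ (suc n) c f =
  trans (cong (_+_ (c * f zero)) (Σ-distribˡ n c (λ i → f (suc i)))) (sym (*-distribˡ-+ c (f zero) _))

Σ-combine : ∀ b n (f : Fin (b * n) → ℕ) →
  Σ[< b * n ] f ≡ Σ[< b ] (λ i → Σ[< n ] (λ j → f (combine i j)))
Σ-combine zero    n f = refl
Σ-combine (suc b) n f =
  trans (Σ-++ n (b * n) f) (cong (_+_ (Σ[< n ] (λ j → f (j ↑ˡ (b * n))))) (Σ-combine b n (λ l → f (n ↑ʳ l))))

Σ-quotient : ∀ b n (h : Fin b → ℕ) → Σ[< b * n ] (λ l → h (quotient n l)) ≡ n * Σ[< b ] h
Σ-quotient b n h = begin
  Σ[< b * n ] (λ l → h (quotient n l))                       ≡⟨ Σ-combine b n _ ⟩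
  Σ[< b ] (λ i → Σ[< n ] (λ j → h (quotient n (combine i j)))) ≡⟨ Σ-cong b (λ i → Σ-cong n (λ j → cong h (quotient-combine i j))) ⟩
  Σ[< b ] (λ i → Σ[< n ] (λ _ → h i))                         ≡⟨ Σ-cong b (λ i → Σ-const n (h i)) ⟩
  Σ[< b ] (λ i → n * h i)                                     ≡⟨ Σ-distribˡ b n h ⟩
  n * Σ[< b ] h                                               ∎
  where
  quotient-combine : ∀ {n} (i : Fin b) (j : Fin n) → quotient n (combine i j) ≡ i
  quotient-combine i j = cong proj₁ (remQuot-combine i j)

concurrence-⊗J : ∀ {v b} (N : Mat v b) m n (x y : Fin (v * m)) →
  concurrence (N ⊗J[ m , n ]) x y ≡ n * concurrence N (quotient m x) (quotient m y)
concurrence-⊗J {b = b} N m n x y = Σ-quotient b n (λ j → N (quotient m x) j * N (quotient m y) j)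

-- The row-major index of (i, j) in an n × k array goes to that of (j, i) in the k × n array.
transposeIndex : ∀ n k → Fin (n * k) → Fin (k * n)
transposeIndex n k x = uncurry combine (swap (remQuot {n} k x))

transposeIndex-involutive : ∀ n k (x : Fin (n * k)) → transposeIndex k n (transposeIndex n k x) ≡ x
transposeIndex-involutive n k x =
  trans (cong (λ p → uncurry combine (swap p)) (remQuot-combine (remainder {n} k x) (quotient {n} k x)))
        (combine-remQuot {n} k x)

transposeIndexₚ : ∀ n k → Permutation (n * k) (k * n)
transposeIndexₚ n k = permutation (transposeIndex n k) (transposeIndex k n)
  (transposeIndex-involutive k n) (transposeIndex-involutive n k)

quotient-transposeIndex : ∀ n k (x : Fin (n * k)) → quotient n (transposeIndex n k x) ≡ remainder {n} k x
quotient-transposeIndex n k x = cong proj₁ (remQuot-combine (remainder {n} k x) (quotient {n} k x))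

toℕ-remQuot : ∀ {n} k (x : Fin (n * k)) → toℕ x ≡ k * toℕ (quotient {n} k x) + toℕ (remainder {n} k x)
toℕ-remQuot {n} k x = trans (cong toℕ (sym (combine-remQuot {n} k x))) (toℕ-combine (quotient {n} k x) (remainder {n} k x))

remainder-congruent : ∀ {n} k (x : Fin (n * k)) → + k ∣ (+ toℕ x - + toℕ (remainder {n} k x))
remainder-congruent {n} k x = divides (+ q) (begin
  + toℕ x - + r              ≡⟨ cong (λ t → + t - + r) (toℕ-remQuot {n} k x) ⟩
  + (k * q + r) - + r        ≡⟨ cong (_- + r) (trans (pos-+ (k * q) r) (cong (ℤ._+ + r) (pos-* k q))) ⟩
  + k ℤ.* + q ℤ.+ + r - + r  ≡⟨ cancel (+ k) (+ q) (+ r) ⟩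
  + q ℤ.* + k                ∎)
  where
  q = toℕ (quotient {n} k x)
  r = toℕ (remainder {n} k x)
  cancel : ∀ (K Q R : ℤ) → K ℤ.* Q ℤ.+ R - R ≡ Q ℤ.* K
  cancel = solve-∀

offset : ∀ {w} → Fin w → Fin w → ℤ
offset x y = + toℕ y - + toℕ x

IsCirculant-reindex : ∀ {v w} {M : Mat v v} (ρ : Fin w → Fin v) → v ∣ℕ w →
  (∀ x → + v ∣ (+ toℕ x - + toℕ (ρ x))) →
  IsCirculant M → IsCirculant (λ x y → M (ρ x) (ρ y))
IsCirculant-reindex {v} ρ v∣w ρ-congruent circ x y x' y' w∣δ =
  circ (ρ x) (ρ y) (ρ x') (ρ y') (∣⇒∣ᵤ (subst (+ v ∣_) (sym regroup) v∣δ-shift))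
  where
  shift : Fin _ → ℤ
  shift z = + toℕ z - + toℕ (ρ z)

  v∣δ-shift : + v ∣ ((offset x y - offset x' y') - ((shift y - shift x) - (shift y' - shift x')))
  v∣δ-shift = ∣m∣n⇒∣m-n {m = offset x y - offset x' y'} (∣ᵤ⇒∣ (∣-trans v∣w w∣δ))
    (∣m∣n⇒∣m-n (∣m∣n⇒∣m-n (ρ-congruent y) (ρ-congruent x)) (∣m∣n⇒∣m-n (ρ-congruent y') (ρ-congruent x')))

  regroup : offset (ρ x) (ρ y) - offset (ρ x') (ρ y')
          ≡ (offset x y - offset x' y') - ((shift y - shift x) - (shift y' - shift x'))
  regroup = identity (+ toℕ x) (+ toℕ y) (+ toℕ x') (+ toℕ y')
                     (+ toℕ (ρ x)) (+ toℕ (ρ y)) (+ toℕ (ρ x')) (+ toℕ (ρ y'))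
    where
    identity : ∀ (X Y X' Y' RX RY RX' RY' : ℤ) →
      (RY - RX) - (RY' - RX') ≡ ((Y - X) - (Y' - X')) - (((Y - RY) - (X - RX)) - ((Y' - RY') - (X' - RX')))
    identity = solve-∀

mainTheorem3 : ∀ {v b : ℕ} (N : Mat v b) (k r α β : ℕ) →
    IsPGD N k r α β →
    IsCirculant (concurrence N) →
    (m n : ℕ) → m ≥ 1 → n ≥ 1 →
    Σ (Permutation′ (v * m)) (λ σ →
      IsCirculant (concurrence (reorderRows σ (N ⊗J[ m , n ]))))
mainTheorem3 {v} N _ _ _ _ _ circ m n _ _ = σ , λ x y x' y' vm∣δ → begin
  concurrence (N ⊗J[ m , n ]) (σ ⟨$⟩ʳ x) (σ ⟨$⟩ʳ y)    ≡⟨ concurrence-⊗J N m n _ _ ⟩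
  n * concurrence N (ρ x) (ρ y)                        ≡⟨ cong (n *_) (circ-ρ x y x' y' vm∣δ) ⟩
  n * concurrence N (ρ x') (ρ y')                      ≡⟨ concurrence-⊗J N m n _ _ ⟨
  concurrence (N ⊗J[ m , n ]) (σ ⟨$⟩ʳ x') (σ ⟨$⟩ʳ y')  ∎
  where
  σ : Permutation′ (v * m)
  σ = cast-id (*-comm v m) ∘ₚ transposeIndexₚ m v

  ρ : Fin (v * m) → Fin v
  ρ x = quotient m (σ ⟨$⟩ʳ x)

  ρ-congruent : ∀ x → + v ∣ (+ toℕ x - + toℕ (ρ x))
  ρ-congruent x = subst (+ v ∣_)
    (cong₂ (λ i j → + i - + toℕ j) (toℕ-cast (*-comm v m) x) (sym (quotient-transposeIndex m v _)))
    (remainder-congruent {m} v (cast (*-comm v m) x))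

  circ-ρ : IsCirculant (λ x y → concurrence N (ρ x) (ρ y))
  circ-ρ = IsCirculant-reindex ρ (m∣m*n m) ρ-congruent circ
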